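{- Let $k_0$ and $m$ be positive integers, let $p_1 < p_2 < \cdots$ be the primes, and put $M_m = p_1 p_2 \cdots p_m$ and $R_m = (p_1 - 1)(p_2 - 1)\cdots(p_m - 1)$. If $\mathcal{H} = \{h_1, \ldots, h_{k_0}\}$ is an admissible set of $k_0$ distinct non-negative integers, then its length $\max \mathcal{H} - \min \mathcal{H}$ satisfies $$\max \mathcal{H} - \min \mathcal{H} \geq M_m\left(\frac{k_0}{R_m} - 1\right).$$ In particular (taking $m=1$), the length of any admissible set of $k_0$ elements is at least $2(k_0 - 1)$.
   Context: A finite set $\mathcal{H}$ of distinct non-negative integers is called admissible if $\nu_p(\mathcal{H}) < p$ for every prime $p$, where $\nu_p(\mathcal{H})$ denotes the number of distinct residue classes modulo $p$ that contain at least one element of $\mathcal{H}$. The length of $\mathcal{H}$ is $\max\mathcal{H} - \min\mathcal{H}$. -}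

module Defs where

open import Data.Nat using (ℕ; zero; suc; _+_; _*_; _∸_; _<_; _≤_; NonZero; _≟_; _⊔_; _⊓_)
open import Data.Nat using (>-nonZero)
open import Data.Nat.Properties using (m*n≢0; ≤-refl; ≤-trans; n≤1+n; ∸-monoˡ-≤)
open import Data.Nat.DivMod using (_%_)
open import Data.Nat.Primality using (Prime; prime?; prime⇒nonZero)
open import Data.Nat using (_!)
open import Data.List using (List; []; _∷_; length; filter; upTo; foldr)
open import Data.List.Relation.Unary.Any using (any?)
open import Relation.Nullary using (yes; no)

ν : (p : ℕ) .{{_ : NonZero p}} → List ℕ → ℕ
ν p H = length (filter (λ r → any? (λ h → h % p ≟ r) H) (upTo p))

Admissible : List ℕ → Set
Admissible H = ∀ (p : ℕ) (pr : Prime p) → ν p {{prime⇒nonZero pr}} H < p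

maxL : List ℕ → ℕ
maxL [] = 0
maxL (x ∷ xs) = foldr _⊔_ x xs

minL : List ℕ → ℕ
minL [] = 0
minL (x ∷ xs) = foldr _⊓_ x xs

lengthH : List ℕ → ℕ
lengthH H = maxL H ∸ minL H

searchPrime : ℕ → ℕ → ℕ
searchPrime n zero = n
searchPrime n (suc fuel) with prime? (suc n)
... | yes _ = suc n
... | no _ = searchPrime (suc n) fuel

-- the least prime > n (exists in (n, n!+1] by Euclid).
nextPrime : ℕ → ℕ
nextPrime n = searchPrime n (n !)

-- nthPrime i = p_{i+1}: nthPrime 0 = 2, nthPrime 1 = 3, …
nthPrime : ℕ → ℕ
nthPrime zero = 2
nthPrime (suc i) = nextPrime (nthPrime i)

primorial : ℕ → ℕ
primorial zero = 1
primorial (suc m) = primorial m * nthPrime m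

R : ℕ → ℕ
R zero = 1
R (suc m) = R m * (nthPrime m ∸ 1)

-- R_m ≠ 0 (every prime is ≥ 2); needed to divide by R_m.
searchPrime-≥ : ∀ n f → n ≤ searchPrime n f
searchPrime-≥ n zero = ≤-refl
searchPrime-≥ n (suc f) with prime? (suc n)
... | yes _ = n≤1+n n
... | no _ = ≤-trans (n≤1+n n) (searchPrime-≥ (suc n) f)

nthPrime-≥2 : ∀ i → 2 ≤ nthPrime i
nthPrime-≥2 zero = ≤-refl
nthPrime-≥2 (suc i) = ≤-trans (nthPrime-≥2 i) (searchPrime-≥ (nthPrime i) (nthPrime i !))

R-nonZero : ∀ m → NonZero (R m)
R-nonZero zero = _
R-nonZero (suc m) = m*n≢0 (R m) (nthPrime m ∸ 1) {{R-nonZero m}} {{>-nonZero (∸-monoˡ-≤ 1 (nthPrime-≥2 m))}}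

{-# OPTIONS --safe #-}
module Submission where

-- Admissibility gives, for each of the first m primes p_i, a residue class r_i mod p_i
-- missed by H, so every element of H survives the sieve that deletes these classes.
-- As the p_i are pairwise coprime, any M_m consecutive integers contain at most R_m
-- survivors: split them by their residue c mod M_{m-1}; for fixed c the p_m integers
-- c + M_{m-1} j (j < p_m) run through every class mod p_m, so at most p_m - 1 of them
-- avoid r_m. If L is the length of H and q the least integer with L < q M_m, then H lies
-- in q consecutive blocks of length M_m, whence k_0 ≤ q R_m and
-- M_m k_0 ≤ q M_m R_m ≤ (L + M_m) R_m.

open import Defs
open import Data.Nat using (ℕ; suc; NonZero)

module Primes where

  open import Data.Nat
  open import Data.Nat.Properties
  open import Data.Nat.Divisibility
  open import Data.Nat.Primality
  open import Data.Nat.Primality.Factorisation using (factorise)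
  open import Data.Nat.ListAction using (product)
  open import Data.List.Base using ([]; _∷_)
  open import Data.List.Relation.Unary.All using (_∷_)
  open import Data.Product using (∃-syntax; _×_; _,_; proj₁; proj₂; map₂)
  open import Data.Sum using (inj₁; inj₂)
  open import Relation.Nullary using (yes; no; contradiction)
  open import Relation.Binary.PropositionalEquality

  m≤n⇒m∣n! : ∀ {m n} .{{_ : NonZero m}} → m ≤ n → m ∣ n !
  m≤n⇒m∣n! {suc m} m≤n = ∣-trans (m∣m*n (m !)) (m≤n⇒m!∣n! m≤n)

  ∃-prime-divisor : ∀ n → 1 < n → ∃[ q ] Prime q × q ∣ n
  ∃-prime-divisor n@(suc _) 1<n with factorise n
  ... | record { factors = [] ; isFactorisation = n≡1 } = contradiction n≡1 (>⇒≢ 1<n)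
  ... | record { factors = q ∷ qs ; isFactorisation = n≡q*qs ; factorsPrime = q-prime ∷ _ } =
    q , q-prime , subst (q ∣_) (sym n≡q*qs) (m∣m*n (product qs))

  -- Euclid: a prime factor of n! + 1 cannot be at most n.
  ∃-prime-above : ∀ n → ∃[ q ] Prime q × n < q × q ≤ suc (n !)
  ∃-prime-above n with ∃-prime-divisor (suc (n !)) (s≤s (1≤n! n))
  ... | q , q-prime , q∣1+n! = q , q-prime , ≰⇒> q≰n , ∣⇒≤ q∣1+n!
    where
    q≰n : q ≰ n
    q≰n q≤n = ¬prime[1] (subst Prime (∣1⇒≡1 q∣1) q-prime)
      where
      q∣1 : q ∣ 1
      q∣1 = ∣m+n∣m⇒∣n (subst (q ∣_) (+-comm 1 (n !)) q∣1+n!)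
                      (m≤n⇒m∣n! {{prime⇒nonZero q-prime}} q≤n)

  searchPrime-finds : ∀ {n q} f → Prime q → n < q → q ≤ n + f
                    → Prime (searchPrime n f) × n < searchPrime n f
  searchPrime-finds {n} zero _ n<q q≤n+0 = contradiction (subst (_ ≤_) (+-identityʳ n) q≤n+0) (<⇒≱ n<q)
  searchPrime-finds {n} {q} (suc f) q-prime n<q q≤n+1+f with prime? (suc n)
  ... | yes 1+n-prime = 1+n-prime , ≤-refl
  ... | no 1+n-composite with m≤n⇒m<n∨m≡n n<q
  ...   | inj₂ refl = contradiction q-prime 1+n-composite
  ...   | inj₁ 1+n<q = map₂ <⇒≤ (searchPrime-finds f q-prime 1+n<q (subst (q ≤_) (+-suc n f) q≤n+1+f))

  nextPrime-spec : ∀ n → 0 < n → Prime (nextPrime n) × n < nextPrime n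
  nextPrime-spec n 0<n with ∃-prime-above n
  ... | q , q-prime , n<q , q≤1+n! = searchPrime-finds (n !) q-prime n<q (≤-trans q≤1+n! (+-monoˡ-≤ (n !) 0<n))

  nthPrime-prime : ∀ i → Prime (nthPrime i)
  nthPrime-prime zero    = prime[2]
  nthPrime-prime (suc i) = proj₁ (nextPrime-spec (nthPrime i) (<⇒≤ (nthPrime-≥2 i)))

  nthPrime-<-suc : ∀ i → nthPrime i < nthPrime (suc i)
  nthPrime-<-suc i = proj₂ (nextPrime-spec (nthPrime i) (<⇒≤ (nthPrime-≥2 i)))

  nthPrime-strictMono : ∀ {i j} → i < j → nthPrime i < nthPrime j
  nthPrime-strictMono {i} {suc j} i<1+j with m≤n⇒m<n∨m≡n (s≤s⁻¹ i<1+j)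
  ... | inj₁ i<j  = <-trans (nthPrime-strictMono i<j) (nthPrime-<-suc j)
  ... | inj₂ refl = nthPrime-<-suc i

module Sums where

  open import Data.Bool.Base using (Bool; true; false; _∧_)
  open import Data.Nat
  open import Data.Nat.Properties
  open import Algebra.Properties.CommutativeSemigroup +-commutativeSemigroup using (interchange)
  open import Data.Sum using (inj₁; inj₂)
  open import Function.Base using (_∘_)
  open import Relation.Nullary using (Dec; yes; no; does; ¬_; contradiction)
  open import Relation.Nullary.Decidable using (dec-true)
  open import Relation.Binary.PropositionalEquality

  ∑< : ℕ → (ℕ → ℕ) → ℕ
  ∑< zero    g = 0
  ∑< (suc n) g = ∑< n g + g n

  ∏< : ℕ → (ℕ → ℕ) → ℕ
  ∏< zero    g = 1
  ∏< (suc n) g = ∏< n g * g n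

  syntax ∑< n (λ u → e) = ∑[ u < n ] e
  syntax ∏< n (λ u → e) = ∏[ u < n ] e

  χ : Bool → ℕ
  χ true  = 1
  χ false = 0

  χ≤1 : ∀ b → χ b ≤ 1
  χ≤1 true  = ≤-refl
  χ≤1 false = z≤n

  χ-∧ : ∀ b c → χ (b ∧ c) ≡ χ b * χ c
  χ-∧ true  c = sym (+-identityʳ (χ c))
  χ-∧ false c = refl

  χ-does-≤ : ∀ {A : Set} (A? : Dec A) {b} → (A → b ≡ true) → χ (does A?) ≤ χ b
  χ-does-≤ (yes a) a⇒b rewrite a⇒b a = ≤-refl
  χ-does-≤ (no _)  _   = z≤n

  χ-does-+ : ∀ {A B C : Set} (A? : Dec A) (B? : Dec B) (C? : Dec C)
           → (A → ¬ B) → (A → C) → (B → C) → χ (does A?) + χ (does B?) ≤ χ (does C?)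
  χ-does-+ (yes a) (yes b) _  A⇒¬B _   _   = contradiction b (A⇒¬B a)
  χ-does-+ (yes a) (no _)  C? _    A⇒C _   = χ-does-≤ (yes a) (dec-true C? ∘ A⇒C)
  χ-does-+ (no _)  B?      C? _    _   B⇒C = χ-does-≤ B? (dec-true C? ∘ B⇒C)

  ∏-nonZero : ∀ (g : ℕ → ℕ) → (∀ i → NonZero (g i)) → ∀ n → NonZero (∏< n g)
  ∏-nonZero g g≢0 zero    = _
  ∏-nonZero g g≢0 (suc n) = m*n≢0 (∏< n g) (g n) {{∏-nonZero g g≢0 n}} {{g≢0 n}}

  ∑-zero : ∀ n → ∑[ _ < n ] 0 ≡ 0
  ∑-zero zero    = refl
  ∑-zero (suc n) = trans (+-identityʳ _) (∑-zero n)

  module _ {f g : ℕ → ℕ} where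

    ∑-cong : ∀ n → (∀ u → f u ≡ g u) → ∑< n f ≡ ∑< n g
    ∑-cong zero    f≗g = refl
    ∑-cong (suc n) f≗g = cong₂ _+_ (∑-cong n f≗g) (f≗g n)

    ∑-mono-≤ : ∀ n → (∀ u → f u ≤ g u) → ∑< n f ≤ ∑< n g
    ∑-mono-≤ zero    f≤g = z≤n
    ∑-mono-≤ (suc n) f≤g = +-mono-≤ (∑-mono-≤ n f≤g) (f≤g n)

    ∑-distrib-+ : ∀ n → ∑[ u < n ] (f u + g u) ≡ ∑< n f + ∑< n g
    ∑-distrib-+ zero    = refl
    ∑-distrib-+ (suc n) =
      trans (cong (_+ (f n + g n)) (∑-distrib-+ n)) (interchange (∑< n f) (∑< n g) (f n) (g n))

  module _ (g : ℕ → ℕ) where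

    ∑-distribʳ-* : ∀ n c → ∑[ u < n ] (g u * c) ≡ ∑< n g * c
    ∑-distribʳ-* zero    c = refl
    ∑-distribʳ-* (suc n) c =
      trans (cong (_+ g n * c) (∑-distribʳ-* n c)) (sym (*-distribʳ-+ c (∑< n g) (g n)))

    ∑-distribˡ-* : ∀ n c → ∑[ u < n ] (c * g u) ≡ c * ∑< n g
    ∑-distribˡ-* n c =
      trans (∑-cong n (λ u → *-comm c (g u))) (trans (∑-distribʳ-* n c) (*-comm (∑< n g) c))

    ∑-split : ∀ m n → ∑< (m + n) g ≡ ∑< m g + ∑[ u < n ] g (m + u)
    ∑-split m zero    = trans (cong (λ k → ∑< k g) (+-identityʳ m)) (sym (+-identityʳ (∑< m g)))
    ∑-split m (suc n) = begin
      ∑< (m + suc n) g                             ≡⟨ cong (λ k → ∑< k g) (+-suc m n) ⟩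
      ∑< (m + n) g + g (m + n)                     ≡⟨ cong (_+ g (m + n)) (∑-split m n) ⟩
      ∑< m g + ∑[ u < n ] g (m + u) + g (m + n)    ≡⟨ +-assoc (∑< m g) _ _ ⟩
      ∑< m g + ∑[ u < suc n ] g (m + u)            ∎
      where open ≡-Reasoning

    ∑-blocks : ∀ m n → ∑< (m * n) g ≡ ∑[ c < m ] ∑[ j < n ] g (c + m * j)
    ∑-blocks m zero    = trans (cong (λ k → ∑< k g) (*-zeroʳ m)) (sym (∑-zero m))
    ∑-blocks m (suc n) = begin
      ∑< (m * suc n) g                                                ≡⟨ cong (λ k → ∑< k g) (trans (*-suc m n) (+-comm m (m * n))) ⟩
      ∑< (m * n + m) g                                                ≡⟨ ∑-split (m * n) m ⟩
      ∑< (m * n) g + ∑[ c < m ] g (m * n + c)                         ≡⟨ cong₂ _+_ (∑-blocks m n) (∑-cong m (λ c → cong g (+-comm (m * n) c))) ⟩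
      ∑[ c < m ] ∑[ j < n ] g (c + m * j) + ∑[ c < m ] g (c + m * n)  ≡⟨ ∑-distrib-+ m ⟨
      ∑[ c < m ] ∑[ j < suc n ] g (c + m * j)                         ∎
      where open ≡-Reasoning

    term≤∑ : ∀ {j n} → j < n → g j ≤ ∑< n g
    term≤∑ {j} {suc n} j<1+n with m≤n⇒m<n∨m≡n (s≤s⁻¹ j<1+n)
    ... | inj₁ j<n  = ≤-trans (term≤∑ j<n) (m≤m+n (∑< n g) (g n))
    ... | inj₂ refl = m≤n+m (g j) (∑< j g)

  ∑-periodic-≤ : ∀ (g : ℕ → ℕ) M B → (∀ a → ∑[ u < M ] g (a + u) ≤ B)
               → ∀ n a → ∑[ u < n * M ] g (a + u) ≤ n * B
  ∑-periodic-≤ g M B block≤B zero    a = z≤n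
  ∑-periodic-≤ g M B block≤B (suc n) a = begin
    ∑[ u < M + n * M ] g (a + u)                           ≡⟨ ∑-split (λ u → g (a + u)) M (n * M) ⟩
    ∑[ u < M ] g (a + u) + ∑[ u < n * M ] g (a + (M + u))  ≡⟨ cong (∑[ u < M ] g (a + u) +_) (∑-cong (n * M) (λ u → cong g (+-assoc a M u))) ⟨
    ∑[ u < M ] g (a + u) + ∑[ u < n * M ] g (a + M + u)    ≤⟨ +-mono-≤ (block≤B a) (∑-periodic-≤ g M B block≤B n (a + M)) ⟩
    B + n * B                                              ∎
    where open ≤-Reasoning

  ∑χ≤ : ∀ (f : ℕ → Bool) n → ∑[ u < n ] χ (f u) ≤ n
  ∑χ≤ f zero    = z≤n
  ∑χ≤ f (suc n) = subst (∑[ u < n ] χ (f u) + χ (f n) ≤_) (+-comm n 1) (+-mono-≤ (∑χ≤ f n) (χ≤1 (f n)))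

  ∑χ≤n∸1 : ∀ (f : ℕ → Bool) {j n} → j < n → f j ≡ false → ∑[ u < n ] χ (f u) ≤ n ∸ 1
  ∑χ≤n∸1 f {j} {suc n} j<1+n fj≡false with m≤n⇒m<n∨m≡n (s≤s⁻¹ j<1+n)
  ... | inj₁ j<n  = begin
    ∑[ u < n ] χ (f u) + χ (f n)  ≤⟨ +-mono-≤ (∑χ≤n∸1 f j<n fj≡false) (χ≤1 (f n)) ⟩
    n ∸ 1 + 1                     ≡⟨ m∸n+n≡m (<-≤-trans z<s j<n) ⟩
    n                             ∎
    where open ≤-Reasoning
  ... | inj₂ refl rewrite fj≡false = subst (_≤ j) (sym (+-identityʳ _)) (∑χ≤ f j)

module Residues where

  open import Data.Nat
  open import Data.Nat.Properties
  open import Data.Nat.DivMod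
  open import Data.Nat.Divisibility using (_∣_)
  open import Data.Nat.Coprimality using (Coprime; coprime-Bézout)
  open import Data.Nat.GCD using (module Bézout)
  open import Data.Nat.Primality using (Prime; prime⇒irreducible)
  open import Data.Nat.Tactic.RingSolver using (solve)
  open import Data.List.Base using ([]; _∷_)
  open import Data.Product using (∃-syntax; _×_; _,_)
  open import Data.Sum using (inj₁; inj₂)
  open import Relation.Nullary using (¬_; contradiction)
  open import Relation.Binary.PropositionalEquality

  prime∤⇒coprime : ∀ {p n} → Prime p → ¬ p ∣ n → Coprime n p
  prime∤⇒coprime p-prime p∤n (d∣n , d∣p) with prime⇒irreducible p-prime d∣p
  ... | inj₁ d≡1  = d≡1
  ... | inj₂ refl = contradiction d∣n p∤n

  module _ {n : ℕ} .{{_ : NonZero n}} where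

    %-cong-+ˡ : ∀ c {a b} → a % n ≡ b % n → (c + a) % n ≡ (c + b) % n
    %-cong-+ˡ c {a} {b} a≡b = begin
      (c + a) % n              ≡⟨ %-distribˡ-+ c a n ⟩
      (c % n + a % n) % n      ≡⟨ cong (λ x → (c % n + x) % n) a≡b ⟩
      (c % n + b % n) % n      ≡⟨ %-distribˡ-+ c b n ⟨
      (c + b) % n              ∎
      where open ≡-Reasoning

    %-cong-*ˡ : ∀ c {a b} → a % n ≡ b % n → (c * a) % n ≡ (c * b) % n
    %-cong-*ˡ c {a} {b} a≡b = begin
      (c * a) % n              ≡⟨ %-distribˡ-* c a n ⟩
      (c % n * (a % n)) % n    ≡⟨ cong (λ x → (c % n * x) % n) a≡b ⟩
      (c % n * (b % n)) % n    ≡⟨ %-distribˡ-* c b n ⟨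
      (c * b) % n              ∎
      where open ≡-Reasoning

    %-cong-*ʳ : ∀ c {a b} → a % n ≡ b % n → (a * c) % n ≡ (b * c) % n
    %-cong-*ʳ c {a} {b} a≡b = begin
      (a * c) % n  ≡⟨ cong (_% n) (*-comm a c) ⟩
      (c * a) % n  ≡⟨ %-cong-*ˡ c a≡b ⟩
      (c * b) % n  ≡⟨ cong (_% n) (*-comm c b) ⟩
      (b * c) % n  ∎
      where open ≡-Reasoning

  ∃-multiple-above : ∀ L M .{{_ : NonZero M}} → ∃[ q ] L < q * M × q * M ≤ L + M
  ∃-multiple-above L M = suc (L / M) , L<[1+L/M]*M , subst (M + L / M * M ≤_) (+-comm M L) (+-monoʳ-≤ M (m/n*n≤m L M))
    where
    L<[1+L/M]*M = begin-strict
      L                  ≡⟨ m≡m%n+[m/n]*n L M ⟩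
      L % M + L / M * M  <⟨ +-monoˡ-< (L / M * M) (m%n<n L M) ⟩
      M + L / M * M      ∎
      where open ≤-Reasoning

  coprime⇒inverse : ∀ {m n} .{{_ : NonZero n}} → Coprime m n → ∃[ u ] (m * u) % n ≡ 1 % n
  coprime⇒inverse {m} {n} m⊥n with coprime-Bézout m⊥n
  ... | Bézout.+- x y 1+y*n≡x*m = x , (begin
    (m * x) % n      ≡⟨ cong (_% n) (trans (*-comm m x) (sym 1+y*n≡x*m)) ⟩
    (1 + y * n) % n  ≡⟨ [m+kn]%n≡m%n 1 y n ⟩
    1 % n            ∎)
    where open ≡-Reasoning
  coprime⇒inverse {m} {n@(suc k)} m⊥n | Bézout.-+ x y 1+x*m≡y*n = x * k , (begin
    (m * (x * k)) % n          ≡⟨ [m+n]%n≡m%n (m * (x * k)) n ⟨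
    (m * (x * k) + n) % n      ≡⟨ cong (_% n) shift ⟩
    (1 + y * k * n) % n        ≡⟨ [m+kn]%n≡m%n 1 (y * k) n ⟩
    1 % n                      ∎)
    where
    open ≡-Reasoning
    -- m x ≡ -1 and k ≡ -1 modulo n, so m (x k) ≡ 1.
    shift : m * (x * k) + n ≡ 1 + y * k * n
    shift = begin
      m * (x * k) + suc k    ≡⟨ solve (m ∷ x ∷ k ∷ []) ⟩
      suc ((1 + x * m) * k)  ≡⟨ cong (λ z → suc (z * k)) 1+x*m≡y*n ⟩
      suc (y * n * k)        ≡⟨ solve (y ∷ k ∷ []) ⟩
      1 + y * k * n          ∎

  coprime⇒progression-hits : ∀ {P n} .{{_ : NonZero n}} → Coprime P n
                           → ∀ x {r} → r < n → ∃[ j ] j < n × (x + P * j) % n ≡ r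
  coprime⇒progression-hits {P} {n@(suc k)} P⊥n x {r} r<n with coprime⇒inverse P⊥n
  ... | u , Pu≡1 = j , m%n<n (u * d) n , (begin
    (x + P * j) % n        ≡⟨ %-cong-+ˡ x (%-cong-*ˡ P (m%n%n≡m%n (u * d) n)) ⟩
    (x + P * (u * d)) % n  ≡⟨ cong (λ z → (x + z) % n) (*-assoc P u d) ⟨
    (x + P * u * d) % n    ≡⟨ %-cong-+ˡ x (%-cong-*ʳ d {P * u} {1} Pu≡1) ⟩
    (x + 1 * d) % n        ≡⟨ cong (_% n) x+d≡r+x*n ⟩
    (r + x * n) % n        ≡⟨ [m+kn]%n≡m%n r x n ⟩
    r % n                  ≡⟨ m<n⇒m%n≡m r<n ⟩
    r                      ∎)
    where
    open ≡-Reasoning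
    -- d ≡ r - x modulo n
    d = r + k * x
    j = (u * d) % n
    x+d≡r+x*n : x + 1 * (r + k * x) ≡ r + x * suc k
    x+d≡r+x*n = solve (x ∷ r ∷ k ∷ [])

module Sieve (p : ℕ → ℕ) {{p-nonZero : ∀ {i} → NonZero (p i)}} (r : ℕ → ℕ) where

  open import Data.Bool.Base using (Bool; true; _∧_; not)
  open import Data.Nat
  open import Data.Nat.Properties
  open import Data.Nat.DivMod using (_%_; %-remove-+ʳ)
  open import Data.Nat.Divisibility using (∣-trans; n∣m*n; m∣m*n)
  open import Data.Nat.Coprimality using (Coprime)
  open import Data.Product using (_,_)
  open import Relation.Nullary using (does)
  open import Relation.Nullary.Decidable using (dec-true; dec-false)
  open import Relation.Binary.PropositionalEquality
  open Sums
  open Residues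

  survives : ℕ → ℕ → Bool
  survives zero    x = true
  survives (suc m) x = survives m x ∧ not (does (x % p m ≟ r m))

  survives-periodic : ∀ m x j → survives m (x + ∏[ i < m ] p i * j) ≡ survives m x
  survives-periodic zero    x j = refl
  survives-periodic (suc m) x j = cong₂ (λ b y → b ∧ not (does (y ≟ r m))) earlier (%-remove-+ʳ x p∣)
    where
    P = ∏[ i < m ] p i
    earlier : survives m (x + P * p m * j) ≡ survives m x
    earlier = trans (cong (λ y → survives m (x + y)) (*-assoc P (p m) j)) (survives-periodic m x (p m * j))
    p∣ = ∣-trans (n∣m*n P) (m∣m*n j)

  survives-all : ∀ m {x} → (∀ i → x % p i ≢ r i) → survives m x ≡ true
  survives-all zero    avoids = refl
  survives-all (suc m) {x} avoids
    rewrite survives-all m avoids | dec-false (x % p m ≟ r m) (avoids m) = refl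

  sieve-bound : (∀ i → r i < p i) → (∀ m → Coprime (∏[ i < m ] p i) (p m))
              → ∀ m a → ∑[ u < ∏[ i < m ] p i ] χ (survives m (a + u)) ≤ ∏[ i < m ] (p i ∸ 1)
  sieve-bound r<p coprime zero    a = ≤-refl
  sieve-bound r<p coprime (suc m) a = begin
    ∑[ u < P * q ] χ (survives (suc m) (a + u))                             ≡⟨ ∑-blocks _ P q ⟩
    ∑[ c < P ] ∑[ j < q ] χ (survives (suc m) (a + (c + P * j)))            ≡⟨ ∑-cong P (λ c → ∑-cong q (fibre c)) ⟩
    ∑[ c < P ] ∑[ j < q ] (χ (survives m (a + c)) * χ (misses (a + c) j))   ≡⟨ ∑-cong P (λ c → ∑-distribˡ-* (λ j → χ (misses (a + c) j)) q (χ (survives m (a + c)))) ⟩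
    ∑[ c < P ] (χ (survives m (a + c)) * ∑[ j < q ] χ (misses (a + c) j))   ≤⟨ ∑-mono-≤ P (λ c → *-monoʳ-≤ (χ (survives m (a + c))) (misses-bound (a + c))) ⟩
    ∑[ c < P ] (χ (survives m (a + c)) * (q ∸ 1))                           ≡⟨ ∑-distribʳ-* _ P (q ∸ 1) ⟩
    ∑[ c < P ] χ (survives m (a + c)) * (q ∸ 1)                             ≤⟨ *-monoˡ-≤ (q ∸ 1) (sieve-bound r<p coprime m a) ⟩
    ∏[ i < m ] (p i ∸ 1) * (q ∸ 1)                                          ∎
    where
    open ≤-Reasoning
    P = ∏[ i < m ] p i
    q = p m
    misses : ℕ → ℕ → Bool
    misses x j = not (does ((x + P * j) % q ≟ r m))
    fibre : ∀ c j → χ (survives (suc m) (a + (c + P * j))) ≡ χ (survives m (a + c)) * χ (misses (a + c) j)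
    fibre c j rewrite sym (+-assoc a c (P * j)) =
      trans (cong (λ b → χ (b ∧ misses (a + c) j)) (survives-periodic m (a + c) j)) (χ-∧ (survives m (a + c)) (misses (a + c) j))
    -- the progression x + P j meets the class r m once among p m consecutive steps
    misses-bound : ∀ x → ∑[ j < q ] χ (misses x j) ≤ q ∸ 1
    misses-bound x with coprime⇒progression-hits (coprime m) x (r<p m)
    ... | j , j<q , hit = ∑χ≤n∸1 (misses x) j<q (cong not (dec-true (_ ≟ r m) hit))

module AdmissibleSets where

  open import Data.Bool.Base using (true)
  open import Data.Nat
  open import Data.Nat.Properties
  open import Data.Nat.DivMod
  open import Data.Nat.Divisibility using (_∣_; ∣1⇒≡1)
  open import Data.Nat.Coprimality using (Coprime)
  open import Data.Nat.Primality using (prime⇒nonZero; euclidsLemma; prime⇒irreducible)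
  open import Data.List.Base using (List; []; _∷_; length; upTo; filter)
  open import Data.List.Properties using (filter-all; length-upTo; foldr-preservesᵒ)
  open import Data.List.Membership.Propositional using (_∈_; _∉_; find)
  open import Data.List.Membership.Propositional.Properties using (∈-upTo⁻)
  open import Data.List.Membership.DecPropositional _≟_ using (_∈?_)
  open import Data.List.Relation.Unary.All as All using (All; _∷_; all?)
  open import Data.List.Relation.Unary.All.Properties using (¬Any⇒All¬; ¬All⇒Any¬; All¬⇒¬Any)
  open import Data.List.Relation.Unary.Any as Any using (Any; here; there; any?)
  open import Data.List.Relation.Unary.Unique.Propositional using (Unique; []; _∷_)
  open import Data.Product using (∃-syntax; _×_; _,_; proj₁; proj₂)
  open import Data.Sum using (_⊎_; inj₁; inj₂; [_,_])
  open import Relation.Nullary using (¬_; yes; no; does; contradiction)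
  open import Relation.Unary using (Decidable)
  open import Relation.Nullary.Decidable using (dec-true)
  open import Relation.Binary.PropositionalEquality hiding ([_])
  open import Function.Base using (_∘_)
  open Primes
  open Sums
  open Residues

  nthPrime-nonZero : ∀ i → NonZero (nthPrime i)
  nthPrime-nonZero i = prime⇒nonZero (nthPrime-prime i)

  primorial≡∏ : ∀ m → primorial m ≡ ∏[ i < m ] nthPrime i
  primorial≡∏ zero    = refl
  primorial≡∏ (suc m) = cong (_* nthPrime m) (primorial≡∏ m)

  R≡∏ : ∀ m → R m ≡ ∏[ i < m ] (nthPrime i ∸ 1)
  R≡∏ zero    = refl
  R≡∏ (suc m) = cong (_* (nthPrime m ∸ 1)) (R≡∏ m)

  nthPrime∤∏ : ∀ {j} m → m ≤ j → ¬ nthPrime j ∣ ∏[ i < m ] nthPrime i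
  nthPrime∤∏ {j} zero    _   pⱼ∣1 = >⇒≢ (nthPrime-≥2 j) (∣1⇒≡1 pⱼ∣1)
  nthPrime∤∏ {j} (suc m) m<j pⱼ∣∏ with euclidsLemma (∏[ i < m ] nthPrime i) (nthPrime m) (nthPrime-prime j) pⱼ∣∏
  ... | inj₁ pⱼ∣∏′ = nthPrime∤∏ m (<⇒≤ m<j) pⱼ∣∏′
  ... | inj₂ pⱼ∣pₘ with prime⇒irreducible (nthPrime-prime m) pⱼ∣pₘ
  ...   | inj₁ pⱼ≡1 = >⇒≢ (nthPrime-≥2 j) pⱼ≡1
  ...   | inj₂ pⱼ≡pₘ = <⇒≢ (nthPrime-strictMono m<j) (sym pⱼ≡pₘ)

  ∏-nthPrime-coprime : ∀ m → Coprime (∏[ i < m ] nthPrime i) (nthPrime m)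
  ∏-nthPrime-coprime m = prime∤⇒coprime (nthPrime-prime m) (nthPrime∤∏ m ≤-refl)

  ∃¬-of-length-filter< : ∀ {P : ℕ → Set} (P? : Decidable P) xs → length (filter P? xs) < length xs
                       → ∃[ x ] x ∈ xs × ¬ P x
  ∃¬-of-length-filter< P? xs filter<xs with all? P? xs
  ... | yes all-P = contradiction (subst (λ ys → length ys < length xs) (filter-all P? all-P) filter<xs) (<-irrefl refl)
  ... | no ¬all-P = find (¬All⇒Any¬ P? xs ¬all-P)

  ∃-missed-residue : ∀ p .{{_ : NonZero p}} H → ν p H < p → ∃[ r ] r < p × All (λ h → h % p ≢ r) H
  ∃-missed-residue p H ν<p
    with ∃¬-of-length-filter< (λ r → any? (λ h → h % p ≟ r) H) (upTo p) (subst (ν p H <_) (sym (length-upTo p)) ν<p)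
  ... | r , r∈ , ¬hit = r , ∈-upTo⁻ r∈ , ¬Any⇒All¬ H ¬hit

  length≤∑χ∈ : ∀ {a N} H → Unique H → All (λ h → a ≤ h × h < a + N) H
             → length H ≤ ∑[ u < N ] χ (does (a + u ∈? H))
  length≤∑χ∈ []      _ _ = z≤n
  length≤∑χ∈ {a} {N} (x ∷ H) (x≢H ∷ uH) ((a≤x , x<a+N) ∷ H-in) = begin
    1 + length H                                                     ≤⟨ +-mono-≤ x-counted (length≤∑χ∈ H uH H-in) ⟩
    ∑[ u < N ] χ (does (a + u ≟ x)) + ∑[ u < N ] χ (does (a + u ∈? H)) ≡⟨ ∑-distrib-+ N ⟨
    ∑[ u < N ] (χ (does (a + u ≟ x)) + χ (does (a + u ∈? H)))        ≤⟨ ∑-mono-≤ N (λ u → χ-does-+ (a + u ≟ x) (a + u ∈? H) (a + u ∈? x ∷ H) x∉ here there) ⟩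
    ∑[ u < N ] χ (does (a + u ∈? x ∷ H))                              ∎
    where
    open ≤-Reasoning
    x∉ : ∀ {y} → y ≡ x → y ∉ H
    x∉ refl = All¬⇒¬Any x≢H
    a+[x∸a]≡x = m+[n∸m]≡n a≤x
    x-counted : 1 ≤ ∑[ u < N ] χ (does (a + u ≟ x))
    x-counted = subst (_≤ ∑[ u < N ] χ (does (a + u ≟ x))) (cong χ (dec-true (a + (x ∸ a) ≟ x) a+[x∸a]≡x))
                      (term≤∑ (λ u → χ (does (a + u ≟ x))) (+-cancelˡ-< a (x ∸ a) N (subst (_< a + N) (sym a+[x∸a]≡x) x<a+N)))

  minL≤ : ∀ {h} H → h ∈ H → minL H ≤ h
  minL≤ (x ∷ xs) h∈ = foldr-preservesᵒ (λ y z → [ m≤n⇒m⊓o≤n z , m≤n⇒o⊓m≤n y ]) x xs (witness h∈)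
    where
    witness : ∀ {h} → h ∈ x ∷ xs → x ≤ h ⊎ Any (_≤ h) xs
    witness (here refl)  = inj₁ ≤-refl
    witness (there h∈xs) = inj₂ (Any.map (λ { refl → ≤-refl }) h∈xs)

  ≤maxL : ∀ {h} H → h ∈ H → h ≤ maxL H
  ≤maxL (x ∷ xs) h∈ = foldr-preservesᵒ (λ y z → [ m≤n⇒m≤n⊔o z , m≤n⇒m≤o⊔n y ]) x xs (witness h∈)
    where
    witness : ∀ {h} → h ∈ x ∷ xs → h ≤ x ⊎ Any (h ≤_) xs
    witness (here refl)  = inj₁ ≤-refl
    witness (there h∈xs) = inj₂ (Any.map (λ { refl → ≤-refl }) h∈xs)

  ∈⇒≤minL+lengthH : ∀ {h} H → h ∈ H → h ≤ minL H + lengthH H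
  ∈⇒≤minL+lengthH H h∈ = subst (_ ≤_) (sym (m+[n∸m]≡n (≤-trans (minL≤ H h∈) (≤maxL H h∈)))) (≤maxL H h∈)

  primorial-nonZero : ∀ m → NonZero (primorial m)
  primorial-nonZero m = subst NonZero (sym (primorial≡∏ m)) (∏-nonZero nthPrime nthPrime-nonZero m)

  module Sieved {H : List ℕ} (adm : Admissible H) where

    missed : ∀ i → ∃[ r ] r < nthPrime i × All (λ h → _%_ h (nthPrime i) {{nthPrime-nonZero i}} ≢ r) H
    missed i = ∃-missed-residue (nthPrime i) {{nthPrime-nonZero i}} H (adm (nthPrime i) (nthPrime-prime i))

    open Sieve nthPrime {{λ {i} → nthPrime-nonZero i}} (λ i → proj₁ (missed i))

    H-survives : ∀ m {h} → h ∈ H → survives m h ≡ true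
    H-survives m h∈H = survives-all m (λ i → All.lookup (proj₂ (proj₂ (missed i))) h∈H)

    survivors-per-period : ∀ m a → ∑[ u < primorial m ] χ (survives m (a + u)) ≤ R m
    survivors-per-period m a rewrite primorial≡∏ m | R≡∏ m =
      sieve-bound (λ i → proj₁ (proj₂ (missed i))) ∏-nthPrime-coprime m a

    length≤n*R : ∀ m {a} n → Unique H → All (λ h → a ≤ h × h < a + n * primorial m) H → length H ≤ n * R m
    length≤n*R m {a} n uH H-in = begin
      length H                                           ≤⟨ length≤∑χ∈ H uH H-in ⟩
      ∑[ u < n * primorial m ] χ (does (a + u ∈? H))     ≤⟨ ∑-mono-≤ (n * primorial m) (λ u → χ-does-≤ (a + u ∈? H) (H-survives m)) ⟩
      ∑[ u < n * primorial m ] χ (survives m (a + u))    ≤⟨ ∑-periodic-≤ (χ ∘ survives m) (primorial m) (R m) (survivors-per-period m) n a ⟩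
      n * R m                                            ∎
      where open ≤-Reasoning

  admissible-bound : ∀ m H → Unique H → Admissible H → primorial m * length H ≤ (lengthH H + primorial m) * R m
  admissible-bound m H uH adm with ∃-multiple-above (lengthH H) (primorial m) {{primorial-nonZero m}}
  ... | q , L<qM , qM≤L+M = begin
    M * length H       ≤⟨ *-monoʳ-≤ M (Sieved.length≤n*R adm m q uH (All.tabulate in-window)) ⟩
    M * (q * R m)      ≡⟨ trans (cong (_* R m) (*-comm q M)) (*-assoc M q (R m)) ⟨
    q * M * R m        ≤⟨ *-monoˡ-≤ (R m) qM≤L+M ⟩
    (lengthH H + M) * R m  ∎
    where
    open ≤-Reasoning
    M = primorial m
    in-window : ∀ {h} → h ∈ H → minL H ≤ h × h < minL H + q * M
    in-window h∈H = minL≤ H h∈H , ≤-<-trans (∈⇒≤minL+lengthH H h∈H) (+-monoʳ-< (minL H) L<qM)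

module RationalBound where

  open import Data.Nat as ℕ using (suc; NonZero)
  import Data.Nat.Properties as ℕₚ
  open import Data.Integer as ℤ using (+_)
  import Data.Integer.Properties as ℤₚ
  open import Data.Integer.Tactic.RingSolver using (solve-∀)
  open import Data.Rational using (_/_; _*_; _-_; _≤_; 1ℚ)
  open import Data.Rational.Properties using (toℚᵘ-cancel-≤; toℚᵘ-homo-*; toℚᵘ-homo-+; toℚᵘ-homo‿-; toℚᵘ-fromℚᵘ)
  open import Data.Rational.Unnormalised using (mkℚᵘ; *≤*)
  open import Data.Rational.Unnormalised.Properties as ℚᵘₚ using (≃-sym; ≃-trans; ≤-respˡ-≃; ≤-respʳ-≃)
  open import Relation.Binary.PropositionalEquality using (_≡_; sym; trans; cong; subst₂)

  m*[k*1-1*r]*1≡mk-mr : ∀ m k r → m ℤ.* (k ℤ.* + 1 ℤ.+ ℤ.- (+ 1) ℤ.* r) ℤ.* + 1 ≡ m ℤ.* k ℤ.- m ℤ.* r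
  m*[k*1-1*r]*1≡mk-mr = solve-∀

  [l+m]r-mr≡lr : ∀ l m r → (l ℤ.+ m) ℤ.* r ℤ.- m ℤ.* r ≡ l ℤ.* r
  [l+m]r-mr≡lr = solve-∀

  ℚ-bound : ∀ K R M L .{{_ : NonZero R}} → M ℕ.* K ℕ.≤ (L ℕ.+ M) ℕ.* R
          → ((+ M) / 1) * (((+ K) / R) - 1ℚ) ≤ (+ L) / 1
  ℚ-bound K R@(suc R′) M L MK≤[L+M]R =
    toℚᵘ-cancel-≤ (≤-respˡ-≃ (≃-sym lhs≃) (≤-respʳ-≃ (≃-sym (toℚᵘ-fromℚᵘ (mkℚᵘ (+ L) 0))) (*≤* cross)))
    where
    lhs≃ = ≃-trans (toℚᵘ-homo-* ((+ M) / 1) _)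
             (ℚᵘₚ.*-cong (toℚᵘ-fromℚᵘ (mkℚᵘ (+ M) 0))
               (≃-trans (toℚᵘ-homo-+ ((+ K) / R) _) (ℚᵘₚ.+-cong (toℚᵘ-fromℚᵘ (mkℚᵘ (+ K) R′)) (toℚᵘ-homo‿- 1ℚ))))
    R′≡R′*1+0 = sym (trans (ℕₚ.+-identityʳ (R′ ℕ.* 1)) (ℕₚ.*-identityʳ R′))
    mk≤[l+m]r : + M ℤ.* + K ℤ.≤ (+ L ℤ.+ + M) ℤ.* + R
    mk≤[l+m]r = subst₂ ℤ._≤_ (ℤₚ.pos-* M K) (trans (ℤₚ.pos-* (L ℕ.+ M) R) (cong (ℤ._* + R) (ℤₚ.pos-+ L M))) (ℤ.+≤+ MK≤[L+M]R)
    cross = begin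
      + M ℤ.* (+ K ℤ.* + 1 ℤ.+ ℤ.- (+ 1) ℤ.* + R) ℤ.* + 1  ≡⟨ m*[k*1-1*r]*1≡mk-mr (+ M) (+ K) (+ R) ⟩
      + M ℤ.* + K ℤ.- + M ℤ.* + R                           ≤⟨ ℤₚ.+-monoˡ-≤ (ℤ.- (+ M ℤ.* + R)) mk≤[l+m]r ⟩
      (+ L ℤ.+ + M) ℤ.* + R ℤ.- + M ℤ.* + R                 ≡⟨ [l+m]r-mr≡lr (+ L) (+ M) (+ R) ⟩
      + L ℤ.* + R                                           ≡⟨ cong (λ d → + L ℤ.* + suc d) R′≡R′*1+0 ⟩
      + L ℤ.* + suc (R′ ℕ.* 1 ℕ.+ 0)                        ∎
      where open ℤₚ.≤-Reasoning

open import Relation.Binary.PropositionalEquality using (_≡_; refl)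
open import Data.List using (List; length)
open import Data.List.Relation.Unary.Unique.Propositional using (Unique)
open import Data.Integer using (+_)
open import Data.Rational using (_/_; _*_; _-_; _≤_; 1ℚ)

mainTheorem2 : (k₀ m : ℕ) → .{{_ : NonZero k₀}} → .{{_ : NonZero m}}
    → (H : List ℕ) → Unique H → length H ≡ k₀ → Admissible H
    → ((+ primorial m) / 1) * (((+ k₀) / R m) {{R-nonZero m}} - 1ℚ) ≤ (+ lengthH H) / 1
mainTheorem2 .(length H) m H unique refl admissible =
  RationalBound.ℚ-bound (length H) (R m) (primorial m) (lengthH H) {{R-nonZero m}}
    (AdmissibleSets.admissible-bound m H unique admissible)
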